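{- Let $m \ge 2$. Every connected component of the sequential power graph of $\mathbb{Z}/m\mathbb{Z}$ contains exactly one idempotent element of $\mathbb{Z}/m\mathbb{Z}$.
   Context: The sequential power graph of $\mathbb{Z}/m\mathbb{Z}$ is the directed graph with vertex set $\mathbb{Z}/m\mathbb{Z}$ and an edge $(b,c)$ if and only if there exist $a \in \mathbb{Z}/m\mathbb{Z}$ and $i \in \mathbb{N}$ with $b \equiv a^i$ and $c \equiv a^{i+1} \pmod m$. A connected component is a maximal set of vertices any two of which are joined by an undirected path. An element $d$ is idempotent if $d^2 \equiv d \pmod m$. -}

module Defs where

open import Data.Nat using (ℕ; suc; _^_; _*_; _%_; NonZero)
open import Data.Fin using (Fin; toℕ)
open import Data.Product using (∃; ∃-syntax; _×_; _,_)
open import Data.Sum using (_⊎_)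
open import Relation.Binary.PropositionalEquality using (_≡_)
open import Relation.Binary.Construct.Closure.ReflexiveTransitive using (Star)

_≡[mod_]_ : ℕ → (m : ℕ) → .{{NonZero m}} → ℕ → Set
x ≡[mod m ] y = x % m ≡ y % m

-- Edge of the sequential power graph of ℤ/mℤ (vertices = Fin m, i.e. residues 0..m-1):
-- (b,c) is an edge iff ∃ a ∈ ℤ/mℤ, i ∈ ℕ = {1,2,...} with b ≡ a^i, c ≡ a^(i+1) (mod m).
-- i ranges over positive naturals, encoded as i = suc j.
SeqPowEdge : (m : ℕ) → .{{NonZero m}} → Fin m → Fin m → Set
SeqPowEdge m b c =
  ∃[ a ] ∃[ j ] ((toℕ b ≡[mod m ] (toℕ {m} a ^ suc j))
               × (toℕ c ≡[mod m ] (toℕ {m} a ^ suc (suc j))))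

Adjacent : (m : ℕ) → .{{NonZero m}} → Fin m → Fin m → Set
Adjacent m b c = SeqPowEdge m b c ⊎ SeqPowEdge m c b

Connected : (m : ℕ) → .{{NonZero m}} → Fin m → Fin m → Set
Connected m = Star (Adjacent m)

Idempotent : (m : ℕ) → .{{NonZero m}} → Fin m → Set
Idempotent m d = (toℕ d * toℕ d) ≡[mod m ] toℕ d

-- Put N = m!.  The proof rests on one arithmetic fact, the stabilisation of powers:
-- for every x and every multiple n of N,  x^N ≡ x^(N + n) (mod m).  Indeed, among the
-- m + 1 residues x^0, …, x^m two coincide (pigeonhole), say x^i ≡ x^(i+p) with 1 ≤ p
-- and i + p ≤ m; then the powers of x repeat with period p from exponent i on, and N is
-- both ≥ i and divisible by p.
--
-- Stabilisation makes  idempotentOf v = v^N mod m  an idempotent, fixes every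
-- idempotent, and takes the same value at b and a whenever b is a positive power of a.
-- Hence it is constant along the edges (a^i, a^(i+1)) of the graph and so on connected
-- components, while the path v, v^2, …, v^N joins v to idempotentOf v.  So
-- idempotentOf v is an idempotent in the component of v, and every idempotent e
-- connected to v equals idempotentOf e = idempotentOf v.
module Submission where

open import Defs
open import Data.Nat using (ℕ; _≤_; NonZero; zero; suc; _+_; _*_; _^_; _%_; _∸_; _!; s≤s⁻¹; >-nonZero⁻¹)
open import Data.Nat.Properties
open import Data.Nat.DivMod using (_mod_; %-distribˡ-*; m%n%n≡m%n; m%n<n; m<n⇒m%n≡m)
open import Data.Nat.Divisibility using (_∣_; divides; ∣-refl; ∣-trans; ∣⇒≤; n∣m*n; m∣m*n)
open import Algebra.Properties.CommutativeSemigroup +-commutativeSemigroup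
  using (xy∙z≈xz∙y; xy∙z≈x∙zy)
open import Data.Fin using (Fin; toℕ)
open import Data.Fin.Properties using (toℕ-injective; toℕ-fromℕ<; toℕ<n; pigeonhole)
open import Data.Product using (∃-syntax; _×_; _,_)
open import Data.Sum using (inj₁; inj₂)
open import Relation.Binary.PropositionalEquality
open import Relation.Binary.Construct.Closure.ReflexiveTransitive using (ε; _◅_; _◅◅_; fold)

∣n! : ∀ {p} n → 1 ≤ p → p ≤ n → p ∣ n !
∣n! {suc _} zero _ ()
∣n! (suc n) 1≤p p≤1+n with m≤n⇒m<n∨m≡n p≤1+n
... | inj₁ p<1+n = ∣-trans (∣n! n 1≤p (s≤s⁻¹ p<1+n)) (n∣m*n (suc n))
... | inj₂ refl  = m∣m*n (n !)

module Residues (m : ℕ) .{{_ : NonZero m}} where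

  infix 4 _≈_
  _≈_ : ℕ → ℕ → Set
  x ≈ y = x ≡[mod m ] y

  *-cong : ∀ {a b c d} → a ≈ b → c ≈ d → a * c ≈ b * d
  *-cong {a} {b} {c} {d} a≈b c≈d = begin
      (a * c) % m             ≡⟨ %-distribˡ-* a c m ⟩
      (a % m * (c % m)) % m   ≡⟨ cong₂ (λ u v → (u * v) % m) a≈b c≈d ⟩
      (b % m * (d % m)) % m   ≡⟨ %-distribˡ-* b d m ⟨
      (b * d) % m             ∎
    where open ≡-Reasoning

  ^-cong : ∀ {a b} n → a ≈ b → a ^ n ≈ b ^ n
  ^-cong zero    _   = refl
  ^-cong (suc n) a≈b = *-cong a≈b (^-cong n a≈b)

  ^-shift : ∀ x {a b} t → x ^ a ≈ x ^ b → x ^ (a + t) ≈ x ^ (b + t)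
  ^-shift x {a} {b} t h = begin
      x ^ (a + t) % m       ≡⟨ cong (_% m) (^-distribˡ-+-* x a t) ⟩
      (x ^ a * x ^ t) % m   ≡⟨ *-cong h refl ⟩
      (x ^ b * x ^ t) % m   ≡⟨ cong (_% m) (^-distribˡ-+-* x b t) ⟨
      x ^ (b + t) % m       ∎
    where open ≡-Reasoning

  ^-periodic : ∀ x {i p} → x ^ i ≈ x ^ (i + p) → ∀ q → x ^ i ≈ x ^ (i + q * p)
  ^-periodic x {i} {p} h zero    = cong (λ k → x ^ k % m) (sym (+-identityʳ i))
  ^-periodic x {i} {p} h (suc q) = begin
      x ^ i % m                 ≡⟨ h ⟩
      x ^ (i + p) % m           ≡⟨ ^-shift x {i} {i + q * p} p (^-periodic x {i} {p} h q) ⟩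
      x ^ (i + q * p + p) % m   ≡⟨ cong (λ k → x ^ k % m) (xy∙z≈x∙zy i (q * p) p) ⟩
      x ^ (i + suc q * p) % m   ∎
    where open ≡-Reasoning

  ^-eventuallyPeriodic : ∀ x {i p k n} → x ^ i ≈ x ^ (i + p) → i ≤ k → p ∣ n →
                         x ^ k ≈ x ^ (k + n)
  ^-eventuallyPeriodic x {i} {p} {k} h i≤k (divides q refl) = begin
      x ^ k % m                 ≡⟨ cong (λ e → x ^ e % m) i+t≡k ⟨
      x ^ (i + t) % m           ≡⟨ ^-shift x {i} {i + q * p} t (^-periodic x {i} {p} h q) ⟩
      x ^ (i + q * p + t) % m   ≡⟨ cong (λ e → x ^ e % m) (xy∙z≈xz∙y i (q * p) t) ⟩
      x ^ (i + t + q * p) % m   ≡⟨ cong (λ e → x ^ (e + q * p) % m) i+t≡k ⟩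
      x ^ (k + q * p) % m       ∎
    where
    open ≡-Reasoning
    t = k ∸ i
    i+t≡k : i + t ≡ k
    i+t≡k = m+[n∸m]≡n i≤k

  record Repetition (x : ℕ) : Set where
    field
      start period : ℕ
      period≥1     : 1 ≤ period
      bounded      : start + period ≤ m
      repeats      : x ^ start ≈ x ^ (start + period)

  toℕ-mod : ∀ x → toℕ (x mod m) ≡ x % m
  toℕ-mod x = toℕ-fromℕ< (m%n<n x m)

  mod-≈ : ∀ x → toℕ (x mod m) ≈ x
  mod-≈ x = trans (cong (_% m) (toℕ-mod x)) (m%n%n≡m%n x m)

  toℕ-% : ∀ (v : Fin m) → toℕ v % m ≡ toℕ v
  toℕ-% v = m<n⇒m%n≡m (toℕ<n v)

  repetition : ∀ x → Repetition x
  repetition x with pigeonhole ≤-refl (λ (k : Fin (suc m)) → (x ^ toℕ k) mod m)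
  ... | i , j , i<j , same = record
    { start    = toℕ i
    ; period   = toℕ j ∸ toℕ i
    ; period≥1 = m<n⇒0<n∸m i<j
    ; bounded  = subst (_≤ m) (sym i+p≡j) (s≤s⁻¹ (toℕ<n j))
    ; repeats  = trans (sym (toℕ-mod _))
                   (trans (cong toℕ same) (trans (toℕ-mod _) (cong (λ e → x ^ e % m) (sym i+p≡j))))
    }
    where
    i+p≡j : toℕ i + (toℕ j ∸ toℕ i) ≡ toℕ j
    i+p≡j = m+[n∸m]≡n (<⇒≤ i<j)

  ^-stable : ∀ x n → m ! ∣ n → x ^ (m !) ≈ x ^ (m ! + n)
  ^-stable x n m!∣n = ^-eventuallyPeriodic x repeats start≤m! (∣-trans period∣m! m!∣n)
    where
    open Repetition (repetition x)
    instance _ = m !≢0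
    start≤m! : start ≤ m !
    start≤m! = ≤-trans (≤-trans (m≤m+n start period) bounded)
                       (∣⇒≤ (∣n! m (>-nonZero⁻¹ m) ≤-refl))
    period∣m! : period ∣ m !
    period∣m! = ∣n! m period≥1 (≤-trans (m≤n+m period start) bounded)

  idempotentOf : Fin m → Fin m
  idempotentOf v = (toℕ v ^ (m !)) mod m

  idempotentOf-idempotent : ∀ v → Idempotent m (idempotentOf v)
  idempotentOf-idempotent v = begin
      (toℕ (idempotentOf v) * toℕ (idempotentOf v)) % m ≡⟨ cong (λ u → (u * u) % m) (toℕ-mod y) ⟩
      (y % m * (y % m)) % m                             ≡⟨ %-distribˡ-* y y m ⟨
      (y * y) % m                                       ≡⟨ cong (_% m) (^-distribˡ-+-* x (m !) (m !)) ⟨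
      x ^ (m ! + m !) % m                               ≡⟨ ^-stable x (m !) ∣-refl ⟨
      y % m                                             ≡⟨ mod-≈ y ⟨
      toℕ (idempotentOf v) % m                          ∎
    where
    open ≡-Reasoning
    x = toℕ v
    y = x ^ (m !)

  idempotent-^ : ∀ e → Idempotent m e → ∀ k → toℕ e ^ suc k ≈ toℕ e
  idempotent-^ e _    zero    = cong (_% m) (*-identityʳ (toℕ e))
  idempotent-^ e e²≈e (suc k) = trans (*-cong {toℕ e} refl (idempotent-^ e e²≈e k)) e²≈e

  m!≡suc : ∃[ n ] m ! ≡ suc n
  m!≡suc with m ! | 1≤n! m
  ... | suc n | _ = n , refl

  idempotentOf-fixes : ∀ e → Idempotent m e → idempotentOf e ≡ e
  idempotentOf-fixes e e²≈e with m!≡suc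
  ... | n , m!≡1+n = toℕ-injective (begin
      toℕ (idempotentOf e)   ≡⟨ toℕ-mod _ ⟩
      toℕ e ^ (m !) % m      ≡⟨ cong (λ k → toℕ e ^ k % m) m!≡1+n ⟩
      toℕ e ^ suc n % m      ≡⟨ idempotent-^ e e²≈e n ⟩
      toℕ e % m              ≡⟨ toℕ-% e ⟩
      toℕ e                  ∎)
    where open ≡-Reasoning

  idempotentOf-power : ∀ {a b} j → toℕ b ≈ toℕ a ^ suc j → idempotentOf b ≡ idempotentOf a
  idempotentOf-power {a} {b} j b≈a^[1+j] = toℕ-injective (begin
      toℕ (idempotentOf b)      ≡⟨ toℕ-mod _ ⟩
      toℕ b ^ (m !) % m         ≡⟨ ^-cong (m !) b≈a^[1+j] ⟩
      (x ^ suc j) ^ (m !) % m   ≡⟨ cong (_% m) (^-*-assoc x (suc j) (m !)) ⟩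
      x ^ (m ! + j * m !) % m   ≡⟨ ^-stable x (j * m !) (n∣m*n j) ⟨
      x ^ (m !) % m             ≡⟨ toℕ-mod _ ⟨
      toℕ (idempotentOf a)      ∎)
    where
    open ≡-Reasoning
    x = toℕ a

  -- Both ends of an edge (a^i, a^(i+1)) are powers of a, so idempotentOf is constant
  -- along it …
  edge-invariant : ∀ {b c} → SeqPowEdge m b c → idempotentOf b ≡ idempotentOf c
  edge-invariant (a , j , b≈a^[1+j] , c≈a^[2+j]) =
    trans (idempotentOf-power {a} j b≈a^[1+j]) (sym (idempotentOf-power {a} (suc j) c≈a^[2+j]))

  connected-invariant : ∀ {u v} → Connected m u v → idempotentOf u ≡ idempotentOf v
  connected-invariant = fold (λ u v → idempotentOf u ≡ idempotentOf v) step refl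
    where
    step : ∀ {u v w} → Adjacent m u v → idempotentOf v ≡ idempotentOf w →
           idempotentOf u ≡ idempotentOf w
    step (inj₁ u→v) eq = trans (edge-invariant u→v) eq
    step (inj₂ v→u) eq = trans (sym (edge-invariant v→u)) eq

  power-path : ∀ v k → Connected m v ((toℕ v ^ suc k) mod m)
  power-path v zero    = subst (Connected m v) (toℕ-injective v≡v^1) ε
    where
    v≡v^1 : toℕ v ≡ toℕ ((toℕ v ^ 1) mod m)
    v≡v^1 = begin
      toℕ v                     ≡⟨ toℕ-% v ⟨
      toℕ v % m                 ≡⟨ cong (_% m) (*-identityʳ (toℕ v)) ⟨
      toℕ v ^ 1 % m             ≡⟨ toℕ-mod _ ⟨
      toℕ ((toℕ v ^ 1) mod m)   ∎
      where open ≡-Reasoning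
  power-path v (suc k) = power-path v k ◅◅ (inj₁ (v , k , mod-≈ _ , mod-≈ _) ◅ ε)

  connected-idempotentOf : ∀ v → Connected m v (idempotentOf v)
  connected-idempotentOf v with m!≡suc
  ... | n , m!≡1+n = subst (λ k → Connected m v ((toℕ v ^ k) mod m)) (sym m!≡1+n) (power-path v n)

mainTheorem2 : (m : ℕ) → .{{_ : NonZero m}} → 2 ≤ m →
    (v : Fin m) →
    ∃[ d ] ((Idempotent m d × Connected m v d)
    × ((e : Fin m) → Idempotent m e → Connected m v e → e ≡ d))
mainTheorem2 m _ v =
  idempotentOf v , (idempotentOf-idempotent v , connected-idempotentOf v) , unique
  where
  open Residues m
  -- An idempotent e in the component of v is fixed by idempotentOf, which is constant
  -- on that component.
  unique : (e : Fin m) → Idempotent m e → Connected m v e → e ≡ idempotentOf v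
  unique e e²≈e v~e = trans (sym (idempotentOf-fixes e e²≈e)) (sym (connected-invariant v~e))
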